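{- Let $\mathbf{d}=(d_1,\dots,d_n)$ be a graphical sequence with $\sum_{i=1}^n d_i=4(n-1)-2$ and $d_n=3$. Then $\mathbf{d}$ admits a realization with two spanning trees that share one edge (i.e., whose edge sets have exactly one common edge).
   Context: A degree sequence is non-increasing, $d_1\ge\dots\ge d_n\ge 0$; it is graphical if some simple graph on $v_1,\dots,v_n$ has $\deg(v_i)=d_i$ (a realization). -}

module Defs where

open import Data.Nat using (ℕ; zero; suc; _+_; _*_; _∸_; _≤_; _<_)
open import Data.Bool using (Bool; true; false)
open import Data.Fin using (Fin; toℕ; fromℕ)
open import Data.List using (List; []; _∷_; length; map; allFin)
open import Data.Nat.ListAction using (sum)
open import Data.List.Relation.Unary.Unique.Propositional using (Unique)
open import Data.Product using (Σ; ∃; ∃-syntax; _×_; _,_)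
open import Relation.Binary.PropositionalEquality using (_≡_)
open import Relation.Nullary using (¬_)

record Graph (n : ℕ) : Set where
  field
    adj   : Fin n → Fin n → Bool
    sym   : ∀ u v → adj u v ≡ adj v u
    irrefl : ∀ v → adj v v ≡ false
open Graph public

Edge : ∀ {n} → Graph n → Fin n → Fin n → Set
Edge G u v = adj G u v ≡ true

b2n : Bool → ℕ
b2n true  = 1
b2n false = 0

deg : ∀ {n} → Graph n → Fin n → ℕ
deg {n} G v = sum (map (λ w → b2n (adj G v w)) (allFin n))

seqSum : ∀ {n} → (Fin n → ℕ) → ℕ
seqSum {n} d = sum (map d (allFin n))

NonIncreasing : ∀ {n} → (Fin n → ℕ) → Set
NonIncreasing {n} d = ∀ (i j : Fin n) → toℕ i ≤ toℕ j → d j ≤ d i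

DegreeSequence : ∀ {n} → (Fin n → ℕ) → Set
DegreeSequence d = NonIncreasing d

Realizes : ∀ {n} → Graph n → (Fin n → ℕ) → Set
Realizes {n} G d = ∀ (i : Fin n) → deg G i ≡ d i

Graphical : ∀ {n} → (Fin n → ℕ) → Set
Graphical {n} d = DegreeSequence d × Σ (Graph n) (λ G → Realizes G d)

Subgraph : ∀ {n} → Graph n → Graph n → Set
Subgraph {n} H G = ∀ (u v : Fin n) → Edge H u v → Edge G u v

data Walk {n : ℕ} (H : Graph n) : Fin n → Fin n → List (Fin n) → Set where
  here : ∀ {x} → Walk H x x (x ∷ [])
  step : ∀ {x y z vs} → Edge H x y → Walk H y z vs → Walk H x z (x ∷ vs)

Connected : ∀ {n} → Graph n → Set
Connected {n} H = ∀ (u v : Fin n) → ∃[ vs ] Walk H u v vs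

HasCycle : ∀ {n} → Graph n → Set
HasCycle {n} H = Σ (Fin n) λ x → Σ (Fin n) λ y → Σ (List (Fin n)) λ vs →
  Walk H x y vs × Unique vs × 3 ≤ length vs × Edge H y x

Acyclic : ∀ {n} → Graph n → Set
Acyclic H = ¬ HasCycle H

SpanningTree : ∀ {n} → Graph n → Graph n → Set
SpanningTree T G = Subgraph T G × Connected T × Acyclic T

ShareExactlyOneEdge : ∀ {n} → Graph n → Graph n → Set
ShareExactlyOneEdge {n} H₁ H₂ = Σ (Fin n) λ u → Σ (Fin n) λ v →
  toℕ u < toℕ v × Edge H₁ u v × Edge H₂ u v ×
  (∀ (x y : Fin n) → toℕ x < toℕ y → Edge H₁ x y → Edge H₂ x y → (x ≡ u × y ≡ v))

-- Index the vertices 0, …, m and write d x = 3 + e x. The degree sum 4m − 2 says that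
-- Σ e = m − 5. Let T₁ be the Hamiltonian path 0 – 2 – 3 – ⋯ – m – 1, and build T₂ rooted
-- at 0 by handing out 1, 2, …, m in consecutive blocks, vertex x receiving e x + b x
-- children where b = (3, 1, 1, 0, 0, …); these numbers add up to m. As d is non-increasing,
-- a vertex x ≥ 1 with children has e w ≥ 1 for all w ≤ x, so its block starts beyond x + 2.
-- Thus every T₂-edge not at the root is long, whereas T₁ has only short edges and {1, m},
-- which misses T₂ because the block of 1 ends before m. Hence {0, 2} is the only common
-- edge, and in G = T₁ ∪ T₂ each vertex x has degree deg₁ x + deg₂ x − [x ∈ {0, 2}] = 3 + e x.

module Submission where

open import Data.Bool using (true; _∨_)
open import Data.Bool.Properties using (∨-zeroʳ)
open import Data.Fin using (Fin; toℕ; fromℕ; fromℕ<) renaming (zero to fzero; suc to fsuc)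
open import Data.Fin.Properties using (toℕ-injective; toℕ<n; toℕ-fromℕ<; toℕ-fromℕ) renaming (_≟_ to _≟ᶠ_)
open import Data.List using (List; _∷ʳ_; reverse; length; allFin; map; tabulate)
open import Data.List.Properties using (map-tabulate; map-cong; unfold-reverse; length-reverse)
open import Data.List.Relation.Unary.All as All using (All; _∷_)
open import Data.List.Relation.Unary.AllPairs using (_∷_)
open import Data.List.Relation.Unary.Unique.Propositional using (Unique)
import Data.List.Relation.Binary.Permutation.Setoid as Permutation
import Data.List.Relation.Binary.Permutation.Setoid.Properties as PermutationProperties
open import Data.Nat
open import Data.Nat.ListAction using (sum)
open import Data.Nat.Properties
open import Algebra.Properties.CommutativeSemigroup +-commutativeSemigroup using (interchange)
open import Data.Nat.Tactic.RingSolver using (solve-∀)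
open import Data.Product using (Σ; ∃-syntax; _×_; _,_; -,_; proj₁; proj₂)
open import Data.Sum using (_⊎_; inj₁; inj₂; swap; [_,_]′)
open import Function using (_∘_; id; _⇔_; mk⇔)
open import Relation.Binary.PropositionalEquality
open import Relation.Binary.Definitions using (tri<; tri≈; tri>)
open import Relation.Nullary using (¬_; Dec; yes; no; does; ¬?; _×-dec_; _⊎-dec_; contradiction)
open import Relation.Nullary.Decidable using (does-⇔; dec-true; dec-false)
open import Relation.Unary using (Decidable)

open import Defs hiding (sym)

sumBelow : (ℕ → ℕ) → ℕ → ℕ
sumBelow g zero    = 0
sumBelow g (suc n) = sumBelow g n + g n

sumBelow-cong : ∀ {g h} n → (∀ {i} → i < n → g i ≡ h i) → sumBelow g n ≡ sumBelow h n
sumBelow-cong zero    g≗h = refl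
sumBelow-cong (suc n) g≗h = cong₂ _+_ (sumBelow-cong n (g≗h ∘ m<n⇒m<1+n)) (g≗h (n<1+n n))

sumBelow-+ : ∀ g h n → sumBelow (λ i → g i + h i) n ≡ sumBelow g n + sumBelow h n
sumBelow-+ g h zero    = refl
sumBelow-+ g h (suc n) = begin
  sumBelow (λ i → g i + h i) n + (g n + h n)   ≡⟨ cong (_+ (g n + h n)) (sumBelow-+ g h n) ⟩
  sumBelow g n + sumBelow h n + (g n + h n)    ≡⟨ interchange (sumBelow g n) _ _ _ ⟩
  sumBelow g n + g n + (sumBelow h n + h n)    ∎
  where open ≡-Reasoning

sumBelow-const : ∀ k n → sumBelow (λ _ → k) n ≡ n * k
sumBelow-const k zero    = refl
sumBelow-const k (suc n) = trans (cong (_+ k) (sumBelow-const k n)) (+-comm (n * k) k)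

sumBelow-monoˡ-≤ : ∀ {g h} n → (∀ {i} → i < n → g i ≤ h i) → sumBelow g n ≤ sumBelow h n
sumBelow-monoˡ-≤ zero    g≤h = z≤n
sumBelow-monoˡ-≤ (suc n) g≤h = +-mono-≤ (sumBelow-monoˡ-≤ n (g≤h ∘ m<n⇒m<1+n)) (g≤h (n<1+n n))

sumBelow-monoʳ-≤ : ∀ g {i j} → i ≤ j → sumBelow g i ≤ sumBelow g j
sumBelow-monoʳ-≤ g {j = zero}  z≤n = ≤-refl
sumBelow-monoʳ-≤ g {j = suc j} i≤1+j with m≤n⇒m<n∨m≡n i≤1+j
... | inj₁ i<1+j = ≤-trans (sumBelow-monoʳ-≤ g (s≤s⁻¹ i<1+j)) (m≤m+n _ _)
... | inj₂ refl  = ≤-refl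

sumBelow-allFin : ∀ n (g : ℕ → ℕ) → sum (map (g ∘ toℕ) (allFin n)) ≡ sumBelow g n
sumBelow-allFin n g = trans (cong sum (map-tabulate {n = n} (λ i → i) (g ∘ toℕ))) (tabulated n g)
  where
  sumBelow-suc : ∀ g n → sumBelow g (suc n) ≡ g 0 + sumBelow (g ∘ suc) n
  sumBelow-suc g zero    = +-comm 0 (g 0)
  sumBelow-suc g (suc n) = trans (cong (_+ g (suc n)) (sumBelow-suc g n)) (+-assoc (g 0) _ _)

  tabulated : ∀ n (g : ℕ → ℕ) → sum (tabulate {n = n} (g ∘ toℕ)) ≡ sumBelow g n
  tabulated zero    g = refl
  tabulated (suc n) g = trans (cong (g 0 +_) (tabulated n (g ∘ suc))) (sym (sumBelow-suc g n))

count : ∀ {P : ℕ → Set} → Decidable P → ℕ → ℕ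
count P? = sumBelow (λ i → b2n (does (P? i)))

module _ {P Q : ℕ → Set} (P? : Decidable P) (Q? : Decidable Q) where

  count-cong : ∀ n → (∀ {i} → i < n → P i ⇔ Q i) → count P? n ≡ count Q? n
  count-cong n P⇔Q = sumBelow-cong n (λ i<n → cong b2n (does-⇔ (P⇔Q i<n) (P? _) (Q? _)))

  count-⊎ : ∀ n → count (λ i → P? i ⊎-dec Q? i) n + count (λ i → P? i ×-dec Q? i) n
                  ≡ count P? n + count Q? n
  count-⊎ n = begin
    count (λ i → P? i ⊎-dec Q? i) n + count (λ i → P? i ×-dec Q? i) n
      ≡⟨ sym (sumBelow-+ _ _ n) ⟩
    sumBelow (λ i → b2n (does (P? i ⊎-dec Q? i)) + b2n (does (P? i ×-dec Q? i))) n
      ≡⟨ sumBelow-cong n (λ {i} _ → inclusion-exclusion i) ⟩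
    sumBelow (λ i → b2n (does (P? i)) + b2n (does (Q? i))) n
      ≡⟨ sumBelow-+ _ _ n ⟩
    count P? n + count Q? n ∎
    where
    open ≡-Reasoning
    inclusion-exclusion : ∀ i → b2n (does (P? i ⊎-dec Q? i)) + b2n (does (P? i ×-dec Q? i))
                                ≡ b2n (does (P? i)) + b2n (does (Q? i))
    inclusion-exclusion i with P? i | Q? i
    ... | yes _ | yes _ = refl
    ... | yes _ | no  _ = refl
    ... | no  _ | yes _ = refl
    ... | no  _ | no  _ = refl

count-⊥ : ∀ {P : ℕ → Set} (P? : Decidable P) n → (∀ {i} → i < n → ¬ P i) → count P? n ≡ 0
count-⊥ P? n ¬P = begin
  count P? n                ≡⟨ sumBelow-cong n (λ i<n → cong b2n (dec-false (P? _) (¬P i<n))) ⟩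
  sumBelow (λ _ → 0) n      ≡⟨ sumBelow-const 0 n ⟩
  n * 0                     ≡⟨ *-zeroʳ n ⟩
  0                         ∎
  where open ≡-Reasoning

count-≡ : ∀ {a} n → a < n → count (_≟ a) n ≡ 1
count-≡ {a} (suc n) a<1+n with n ≟ a
... | yes refl = cong₂ _+_ (count-⊥ (_≟ n) n (λ i<n i≡n → <-irrefl i≡n i<n)) (cong b2n (dec-true (n ≟ n) refl))
... | no  n≢a  = cong₂ _+_ (count-≡ n (≤∧≢⇒< (s≤s⁻¹ a<1+n) (n≢a ∘ sym))) (cong b2n (dec-false (n ≟ a) n≢a))

count-unique : ∀ {P : ℕ → Set} (P? : Decidable P) {a} n → a < n →
               (∀ {i} → i < n → P i ⇔ i ≡ a) → count P? n ≡ 1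
count-unique P? {a} n a<n P⇔≡a = trans (count-cong P? (_≟ a) n P⇔≡a) (count-≡ n a<n)

count-≤ : ∀ h n → count (_≤? h) n ≡ n ⊓ suc h
count-≤ h zero    = refl
count-≤ h (suc n) with n ≤? h
... | yes n≤h = begin
  count (_≤? h) n + b2n (does (n ≤? h))  ≡⟨ cong₂ _+_ (count-≤ h n) (cong b2n (dec-true (n ≤? h) n≤h)) ⟩
  n ⊓ suc h + 1                          ≡⟨ cong (_+ 1) (m≤n⇒m⊓n≡m (m≤n⇒m≤1+n n≤h)) ⟩
  n + 1                                  ≡⟨ +-comm n 1 ⟩
  suc n                                  ≡⟨ m≤n⇒m⊓n≡m (s≤s n≤h) ⟨
  suc n ⊓ suc h                          ∎
  where open ≡-Reasoning
... | no  n≰h = begin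
  count (_≤? h) n + b2n (does (n ≤? h))  ≡⟨ cong (count (_≤? h) n +_) (cong b2n (dec-false (n ≤? h) n≰h)) ⟩
  count (_≤? h) n + 0                    ≡⟨ +-identityʳ _ ⟩
  count (_≤? h) n                        ≡⟨ count-≤ h n ⟩
  n ⊓ suc h                              ≡⟨ m≥n⇒m⊓n≡n (≰⇒> n≰h) ⟩
  suc h                                  ≡⟨ m≥n⇒m⊓n≡n (m≤n⇒m≤1+n (≰⇒> n≰h)) ⟨
  suc n ⊓ suc h                          ∎
  where open ≡-Reasoning

InInterval : ℕ → ℕ → ℕ → Set
InInterval lo hi i = lo < i × i ≤ hi

inInterval? : ∀ lo hi → Decidable (InInterval lo hi)
inInterval? lo hi i = lo <? i ×-dec i ≤? hi

count-interval : ∀ {lo hi} n → lo ≤ hi → hi < n → count (inInterval? lo hi) n ≡ hi ∸ lo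
count-interval {lo} {hi} n lo≤hi hi<n = begin
  count (inInterval? lo hi) n                         ≡⟨ m+n∸n≡m _ (suc lo) ⟨
  count (inInterval? lo hi) n + suc lo ∸ suc lo       ≡⟨ cong (_∸ suc lo) split ⟩
  suc hi ∸ suc lo                                     ∎
  where
  open ≡-Reasoning
  split : count (inInterval? lo hi) n + suc lo ≡ suc hi
  split = begin
    count (inInterval? lo hi) n + suc lo
      ≡⟨ cong (count (inInterval? lo hi) n +_) (trans (count-≤ lo n) (m≥n⇒m⊓n≡n (<-≤-trans (s≤s lo≤hi) hi<n))) ⟨
    count (inInterval? lo hi) n + count (_≤? lo) n
      ≡⟨ count-⊎ (inInterval? lo hi) (_≤? lo) n ⟨
    count (λ i → inInterval? lo hi i ⊎-dec i ≤? lo) n + count (λ i → inInterval? lo hi i ×-dec i ≤? lo) n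
      ≡⟨ cong₂ _+_ (count-cong (λ i → inInterval? lo hi i ⊎-dec i ≤? lo) (_≤? hi) n (λ _ → below-hi))
                     (count-⊥ (λ i → inInterval? lo hi i ×-dec i ≤? lo) n (λ _ → disjoint)) ⟩
    count (_≤? hi) n + 0
      ≡⟨ trans (+-identityʳ _) (trans (count-≤ hi n) (m≥n⇒m⊓n≡n hi<n)) ⟩
    suc hi ∎
    where
    below-hi : ∀ {i} → (InInterval lo hi i ⊎ i ≤ lo) ⇔ i ≤ hi
    below-hi {i} = mk⇔ (λ { (inj₁ (_ , i≤hi)) → i≤hi ; (inj₂ i≤lo) → ≤-trans i≤lo lo≤hi })
                       (case-lo i)
      where
      case-lo : ∀ i → i ≤ hi → InInterval lo hi i ⊎ i ≤ lo
      case-lo i i≤hi with lo <? i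
      ... | yes lo<i = inj₁ (lo<i , i≤hi)
      ... | no  lo≮i = inj₂ (≮⇒≥ lo≮i)
    disjoint : ∀ {i} → ¬ (InInterval lo hi i × i ≤ lo)
    disjoint ((lo<i , _) , i≤lo) = <-irrefl refl (<-≤-trans lo<i i≤lo)

dec-true⁻¹ : ∀ {A : Set} (a? : Dec A) → does a? ≡ true → A
dec-true⁻¹ (yes a) _  = a
dec-true⁻¹ (no _)  ()

module _ {n} {H : Graph n} where

  edge-sym : ∀ {x y} → Edge H x y → Edge H y x
  edge-sym {x} {y} = trans (Graph.sym H y x)

  walk-last : ∀ {P : Fin n → Set} {x y vs} → Walk H x y vs → All P vs → P y
  walk-last here        (px ∷ _)   = px
  walk-last (step _ xy) (_  ∷ pvs) = walk-last xy pvs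

  walk-head : ∀ {P : Fin n → Set} {x y vs} → Walk H x y vs → All P vs → P x
  walk-head here       (px ∷ _) = px
  walk-head (step _ _) (px ∷ _) = px

  walk-++ : ∀ {x y z vs ws} → Walk H x y vs → Walk H y z ws → ∃[ us ] Walk H x z us
  walk-++ here        yz = -, yz
  walk-++ (step e xy) yz = -, step e (proj₂ (walk-++ xy yz))

  walk-∷ʳ : ∀ {x y z vs} → Walk H x y vs → Edge H y z → Walk H x z (vs ∷ʳ z)
  walk-∷ʳ here        e = step e here
  walk-∷ʳ (step e′ w) e = step e′ (walk-∷ʳ w e)

  walk-reverse : ∀ {x y vs} → Walk H x y vs → Walk H y x (reverse vs)
  walk-reverse here = here
  walk-reverse (step {x = x} {vs = vs} e w) =
    subst (Walk H _ _) (sym (unfold-reverse x vs)) (walk-∷ʳ (walk-reverse w) (edge-sym e))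

unique-reverse : ∀ {A : Set} {xs : List A} → Unique xs → Unique (reverse xs)
unique-reverse {A} {xs} = Unique-resp-↭ (↭-sym (↭-reverse xs))
  where
  open Permutation (setoid A) using (↭-sym)
  open PermutationProperties (setoid A) using (Unique-resp-↭; ↭-reverse)

sign : ℕ → ℕ
sign zero    = 0
sign (suc _) = 1

module ParentTree (m : ℕ) (parent rank : ℕ → ℕ)
                  (parent-≤ : ∀ {x} → x ≤ m → parent x ≤ m)
                  (rank-parent : ∀ {x} → x ≢ 0 → rank (parent x) < rank x) where

  IsChild : ℕ → ℕ → Set
  IsChild x y = x ≢ 0 × parent x ≡ y

  Adjacent : ℕ → ℕ → Set
  Adjacent x y = IsChild x y ⊎ IsChild y x

  isChild? : ∀ x y → Dec (IsChild x y)
  isChild? x y = ¬? (x ≟ 0) ×-dec parent x ≟ y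

  adjacent? : ∀ x y → Dec (Adjacent x y)
  adjacent? x y = isChild? x y ⊎-dec isChild? y x

  child-rank : ∀ {x y} → IsChild x y → rank y < rank x
  child-rank (x≢0 , refl) = rank-parent x≢0

  ¬adjacent-self : ∀ {x} → ¬ Adjacent x x
  ¬adjacent-self (inj₁ x↑x) = <-irrefl refl (child-rank x↑x)
  ¬adjacent-self (inj₂ x↑x) = <-irrefl refl (child-rank x↑x)

  tree : Graph (suc m)
  tree = record
    { adj    = λ u v → does (adjacent? (toℕ u) (toℕ v))
    ; sym    = λ u v → does-⇔ (mk⇔ swap swap) (adjacent? (toℕ u) (toℕ v)) (adjacent? (toℕ v) (toℕ u))
    ; irrefl = λ v → dec-false (adjacent? (toℕ v) (toℕ v)) ¬adjacent-self
    }

  edge⇒adjacent : ∀ {u v} → Edge tree u v → Adjacent (toℕ u) (toℕ v)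
  edge⇒adjacent {u} {v} = dec-true⁻¹ (adjacent? (toℕ u) (toℕ v))

  adjacent⇒edge : ∀ {u v} → Adjacent (toℕ u) (toℕ v) → Edge tree u v
  adjacent⇒edge {u} {v} = dec-true (adjacent? (toℕ u) (toℕ v))

  parentᶠ : Fin (suc m) → Fin (suc m)
  parentᶠ v = fromℕ< (s≤s (parent-≤ (s≤s⁻¹ (toℕ<n v))))

  walk-to-root : ∀ k (v : Fin (suc m)) → rank (toℕ v) < k → ∃[ vs ] Walk tree v fzero vs
  walk-to-root k       fzero      _   = -, here
  walk-to-root (suc k) v@(fsuc _) r<k =
    -, step (adjacent⇒edge (inj₁ v↑p)) (proj₂ (walk-to-root k (parentᶠ v) (≤-trans (child-rank v↑p) (s≤s⁻¹ r<k))))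
    where
    v↑p : IsChild (toℕ v) (toℕ (parentᶠ v))
    v↑p = (λ ()) , sym (toℕ-fromℕ< _)

  connected : Connected tree
  connected u v = walk-++ (proj₂ (walk-to-root _ u ≤-refl)) (walk-reverse (proj₂ (walk-to-root _ v ≤-refl)))

  ≢⇒not-parent : ∀ {a a′ z : Fin (suc m)} → IsChild (toℕ a′) (toℕ a) → a ≢ z → toℕ z ≢ parent (toℕ a′)
  ≢⇒not-parent (_ , a′↑a) a≢z z≡p = a≢z (toℕ-injective (sym (trans z≡p a′↑a)))

  descends : ∀ {a b vs} → Walk tree a b vs → Unique vs → All (λ v → toℕ v ≢ parent (toℕ a)) vs →
             a ≢ b → rank (toℕ a) < rank (toℕ b)
  descends here _ _ a≢b = contradiction refl a≢b
  descends {b = b} (step {y = a′} e w) (a∉w ∷ unique-w) (_ ∷ w-avoids) a≢b with edge⇒adjacent e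
  ... | inj₁ (_ , a↑a′) = contradiction (sym a↑a′) (walk-head w w-avoids)
  ... | inj₂ a′↑a with a′ ≟ᶠ b
  ...   | yes refl = child-rank a′↑a
  ...   | no  a′≢b = <-trans (child-rank a′↑a) (descends w unique-w (All.map (≢⇒not-parent a′↑a) a∉w) a′≢b)

  no-cycle-closed-by-parent : ∀ {a b vs} → Walk tree a b vs → Unique vs → 3 ≤ length vs →
                              ¬ IsChild (toℕ a) (toℕ b)
  no-cycle-closed-by-parent here         _ (s≤s ())
  no-cycle-closed-by-parent (step _ here) _ (s≤s (s≤s ()))
  no-cycle-closed-by-parent {a} {b} (step {y = v} e vb@(step _ w)) (a∉vb ∷ unique-vb@(v∉w ∷ _)) _ a↑b
    with edge⇒adjacent e
  ... | inj₁ a↑v = v≢b (toℕ-injective (trans (sym (proj₂ a↑v)) (proj₂ a↑b)))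
    where
    v≢b : v ≢ b
    v≢b = walk-last w v∉w
  ... | inj₂ v↑a = <-asym (descends vb unique-vb (All.map (≢⇒not-parent v↑a) a∉vb) (walk-last w v∉w))
                          (<-trans (child-rank a↑b) (child-rank v↑a))

  -- The edge closing a cycle joins one of its ends to that end's parent; reversing the
  -- cycle if necessary, that end is the first vertex.
  acyclic : Acyclic tree
  acyclic (x , y , vs , w , unique , 3≤len , e) with edge⇒adjacent e
  ... | inj₁ y↑x = no-cycle-closed-by-parent (walk-reverse w) (unique-reverse unique)
                     (subst (3 ≤_) (sym (length-reverse vs)) 3≤len) y↑x
  ... | inj₂ x↑y = no-cycle-closed-by-parent w unique 3≤len x↑y

  children : ℕ → ℕ
  children x = count (λ y → isChild? y x) (suc m)

  count-parents : ∀ {x} → x ≤ m → count (isChild? x) (suc m) ≡ sign x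
  count-parents {zero}  _   = count-⊥ (isChild? 0) (suc m) (λ _ (0≢0 , _) → 0≢0 refl)
  count-parents {suc x} x≤m = count-unique (isChild? (suc x)) (suc m) (s≤s (parent-≤ x≤m))
                                (λ _ → mk⇔ (sym ∘ proj₂) (λ y≡p → (λ ()) , sym y≡p))

  degree : ∀ v → deg tree v ≡ sign (toℕ v) + children (toℕ v)
  degree v = begin
    deg tree v                                          ≡⟨ sumBelow-allFin (suc m) (λ y → b2n (does (adjacent? x y))) ⟩
    count (adjacent? x) (suc m)                         ≡⟨ +-identityʳ _ ⟨
    count (adjacent? x) (suc m) + 0                     ≡⟨ cong (count (adjacent? x) (suc m) +_) no-two-cycle ⟨
    count (adjacent? x) (suc m) + count both? (suc m)   ≡⟨ count-⊎ (isChild? x) (λ y → isChild? y x) (suc m) ⟩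
    count (isChild? x) (suc m) + children x             ≡⟨ cong (_+ children x) (count-parents (s≤s⁻¹ (toℕ<n v))) ⟩
    sign x + children x                                 ∎
    where
    open ≡-Reasoning
    x = toℕ v
    both? : ∀ y → Dec (IsChild x y × IsChild y x)
    both? y = isChild? x y ×-dec isChild? y x
    no-two-cycle : count both? (suc m) ≡ 0
    no-two-cycle = count-⊥ both? (suc m) (λ _ (x↑y , y↑x) → <-asym (child-rank x↑y) (child-rank y↑x))

-- Blocks of sizes c 0, c 1, … partition 1, 2, 3, …; blockOf v k is junk unless 0 < v ≤ offset k.
module Blocks (c : ℕ → ℕ) where

  offset : ℕ → ℕ
  offset = sumBelow c

  InBlock : ℕ → ℕ → Set
  InBlock u = InInterval (offset u) (offset (suc u))

  blockOf : ℕ → ℕ → ℕ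
  blockOf v zero    = 0
  blockOf v (suc k) with v ≤? offset k
  ... | yes _ = blockOf v k
  ... | no  _ = k

  blockOf-≤ : ∀ v k → blockOf v (suc k) ≤ k
  blockOf-≤ v k with v ≤? offset k
  blockOf-≤ v zero    | yes _ = z≤n
  blockOf-≤ v (suc k) | yes _ = m≤n⇒m≤1+n (blockOf-≤ v k)
  blockOf-≤ v k       | no  _ = ≤-refl

  blockOf-∈ : ∀ {v} k → 0 < v → v ≤ offset k → InBlock (blockOf v k) v
  blockOf-∈ {v} zero    0<v v≤0 = contradiction (≤-trans 0<v v≤0) (<-irrefl refl)
  blockOf-∈ {v} (suc k) 0<v v≤offset with v ≤? offset k
  ... | yes v≤offset-k = blockOf-∈ k 0<v v≤offset-k
  ... | no  v≰offset-k = ≰⇒> v≰offset-k , v≤offset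

  block-unique : ∀ {u u′ v} → InBlock u v → InBlock u′ v → u ≡ u′
  block-unique {u} {u′} (su<v , v≤su+) (su′<v , v≤su′+) with <-cmp u u′
  ... | tri≈ _ u≡u′ _ = u≡u′
  ... | tri< u<u′ _ _ = contradiction (<-≤-trans su′<v (≤-trans v≤su+ (sumBelow-monoʳ-≤ c u<u′))) (<-irrefl refl)
  ... | tri> _ _ u′<u = contradiction (<-≤-trans su<v (≤-trans v≤su′+ (sumBelow-monoʳ-≤ c u′<u))) (<-irrefl refl)

  block-nonempty : ∀ {u v} → InBlock u v → 0 < c u
  block-nonempty {u} (su<v , v≤su+) = n≢0⇒n>0 λ cu≡0 →
    <-irrefl refl (<-≤-trans su<v (≤-trans v≤su+ (≤-reflexive (trans (cong (offset u +_) cu≡0) (+-identityʳ _)))))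

_∪_ : ∀ {n} → Graph n → Graph n → Graph n
G ∪ H = record
  { adj    = λ u v → adj G u v ∨ adj H u v
  ; sym    = λ u v → cong₂ _∨_ (Graph.sym G u v) (Graph.sym H u v)
  ; irrefl = λ v → cong₂ _∨_ (irrefl G v) (irrefl H v)
  }

∪-subgraphˡ : ∀ {n} (G H : Graph n) → Subgraph G (G ∪ H)
∪-subgraphˡ G H u v e = cong (_∨ adj H u v) e

∪-subgraphʳ : ∀ {n} (G H : Graph n) → Subgraph H (G ∪ H)
∪-subgraphʳ G H u v e = trans (cong (adj G u v ∨_) e) (∨-zeroʳ _)

lookupℕ : ∀ {n} → (Fin n → ℕ) → ℕ → ℕ
lookupℕ {zero}  f _       = 0
lookupℕ {suc n} f zero    = f fzero
lookupℕ {suc n} f (suc x) = lookupℕ (f ∘ fsuc) x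

lookupℕ-toℕ : ∀ {n} (f : Fin n → ℕ) i → lookupℕ f (toℕ i) ≡ f i
lookupℕ-toℕ f fzero    = refl
lookupℕ-toℕ f (fsuc i) = lookupℕ-toℕ (f ∘ fsuc) i

n+[1+m]*3≡4m∸2⇒n+5≡m : ∀ n m → n + suc m * 3 ≡ 4 * m ∸ 2 → n + 5 ≡ m
n+[1+m]*3≡4m∸2⇒n+5≡m n zero    eq = contradiction (trans (sym (+-suc n 2)) eq) 1+n≢0
n+[1+m]*3≡4m∸2⇒n+5≡m n (suc m) eq = +-cancelʳ-≡ (3 * suc m) (n + 5) (suc m) (begin
  n + 5 + 3 * suc m          ≡⟨ lhs n m ⟩
  n + suc (suc m) * 3 + 2    ≡⟨ cong (_+ 2) eq ⟩
  4 * suc m ∸ 2 + 2          ≡⟨ m∸n+n≡m (≤-trans (s≤s (s≤s z≤n)) (m≤m*n 4 (suc m))) ⟩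
  4 * suc m                  ≡⟨ rhs m ⟩
  suc m + 3 * suc m          ∎)
  where
  open ≡-Reasoning
  lhs : ∀ n m → n + 5 + 3 * suc m ≡ n + suc (suc m) * 3 + 2
  lhs = solve-∀
  rhs : ∀ m → 4 * suc m ≡ suc m + 3 * suc m
  rhs = solve-∀

bonus : ℕ → ℕ
bonus 0                   = 3
bonus 1                   = 1
bonus 2                   = 1
bonus (suc (suc (suc _))) = 0

sumBelow-bonus : ∀ k → sumBelow bonus (3 + k) ≡ 5
sumBelow-bonus zero    = refl
sumBelow-bonus (suc k) = trans (+-identityʳ _) (sumBelow-bonus k)

module Construction (m : ℕ) (d : Fin (suc m) → ℕ) (d-antitone : NonIncreasing d)
                    (d-sum : seqSum d ≡ 4 * (suc m ∸ 1) ∸ 2) (d-last : d (fromℕ m) ≡ 3) where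

  dℕ : ℕ → ℕ
  dℕ = lookupℕ d

  dℕ-antitone : ∀ {x y} → x ≤ y → y ≤ m → dℕ y ≤ dℕ x
  dℕ-antitone {x} {y} x≤y y≤m =
    subst₂ _≤_ (sym (at y≤m)) (sym (at (≤-trans x≤y y≤m)))
      (d-antitone _ _ (subst₂ _≤_ (sym (toℕ-fromℕ< _)) (sym (toℕ-fromℕ< _)) x≤y))
    where
    at : ∀ {z} (z≤m : z ≤ m) → dℕ z ≡ d (fromℕ< (s≤s z≤m))
    at z≤m = trans (cong dℕ (sym (toℕ-fromℕ< (s≤s z≤m)))) (lookupℕ-toℕ d _)

  3≤dℕ : ∀ {x} → x ≤ m → 3 ≤ dℕ x
  3≤dℕ {x} x≤m = subst (_≤ dℕ x) (trans (cong dℕ (sym (toℕ-fromℕ m))) (trans (lookupℕ-toℕ d _) d-last))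
                  (dℕ-antitone x≤m ≤-refl)

  excess : ℕ → ℕ
  excess x = dℕ x ∸ 3

  dℕ≡excess+3 : ∀ {x} → x ≤ m → dℕ x ≡ excess x + 3
  dℕ≡excess+3 x≤m = sym (m∸n+n≡m (3≤dℕ x≤m))

  excess-antitone : ∀ {x y} → x ≤ y → y ≤ m → excess y ≤ excess x
  excess-antitone x≤y y≤m = ∸-monoˡ-≤ 3 (dℕ-antitone x≤y y≤m)

  totalExcess : ℕ
  totalExcess = sumBelow excess (suc m)

  totalExcess+5≡m : totalExcess + 5 ≡ m
  totalExcess+5≡m = n+[1+m]*3≡4m∸2⇒n+5≡m totalExcess m (begin
    totalExcess + suc m * 3                   ≡⟨ cong (totalExcess +_) (sumBelow-const 3 (suc m)) ⟨
    totalExcess + sumBelow (λ _ → 3) (suc m)  ≡⟨ sumBelow-+ excess (λ _ → 3) (suc m) ⟨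
    sumBelow (λ x → excess x + 3) (suc m)     ≡⟨ sumBelow-cong (suc m) (sym ∘ dℕ≡excess+3 ∘ s≤s⁻¹) ⟩
    sumBelow dℕ (suc m)                       ≡⟨ sumBelow-allFin (suc m) dℕ ⟨
    sum (map (dℕ ∘ toℕ) (allFin (suc m)))     ≡⟨ cong sum (map-cong (lookupℕ-toℕ d) (allFin (suc m))) ⟩
    seqSum d                                  ≡⟨ d-sum ⟩
    4 * m ∸ 2                                 ∎)
    where open ≡-Reasoning

  2≤m : 2 ≤ m
  2≤m = subst (2 ≤_) totalExcess+5≡m (≤-trans (s≤s (s≤s z≤n)) (m≤n+m 5 totalExcess))

  childCount₂ : ℕ → ℕ
  childCount₂ x = excess x + bonus x

  open Blocks childCount₂

  offset-total : offset (suc m) ≡ m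
  offset-total = begin
    offset (suc m)                                          ≡⟨ sumBelow-+ excess bonus (suc m) ⟩
    totalExcess + sumBelow bonus (suc m)                    ≡⟨ cong (λ k → totalExcess + sumBelow bonus (suc k)) m≡5+E ⟩
    totalExcess + sumBelow bonus (3 + (3 + totalExcess))    ≡⟨ cong (totalExcess +_) (sumBelow-bonus (3 + totalExcess)) ⟩
    totalExcess + 5                                         ≡⟨ totalExcess+5≡m ⟩
    m                                                       ∎
    where
    open ≡-Reasoning
    m≡5+E : m ≡ 5 + totalExcess
    m≡5+E = trans (sym totalExcess+5≡m) (+-comm totalExcess 5)

  offset-2<m : offset 2 < m
  offset-2<m = begin-strict
    offset 2                              ≡⟨ sumBelow-+ excess bonus 2 ⟩
    sumBelow excess 2 + 4                 ≤⟨ +-monoˡ-≤ 4 (sumBelow-monoʳ-≤ excess (s≤s (≤-trans (n≤1+n 1) 2≤m))) ⟩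
    totalExcess + 4                       <⟨ +-monoʳ-< totalExcess (n<1+n 4) ⟩
    totalExcess + 5                       ≡⟨ totalExcess+5≡m ⟩
    m                                     ∎
    where open ≤-Reasoning

  -- For u ≥ 3 a nonempty block needs e u ≥ 1, hence e w ≥ 1 for all w < u as d is non-increasing.
  offset-far : ∀ {u} → 1 ≤ u → u ≤ m → 0 < childCount₂ u → u + 2 ≤ offset u
  offset-far {1} _ _ _ = m≤n+m 3 (excess 0)
  offset-far {2} _ _ _ = +-mono-≤ (m≤n+m 3 (excess 0)) (m≤n+m 1 (excess 1))
  offset-far {u@(suc (suc (suc k)))} _ u≤m 0<cu = begin
    u + 2                                 ≤⟨ +-monoʳ-≤ u (s≤s (s≤s z≤n)) ⟩
    u + 5                                 ≡⟨ cong (_+ 5) (trans (sym (*-identityʳ u)) (sym (sumBelow-const 1 u))) ⟩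
    sumBelow (λ _ → 1) u + 5              ≤⟨ +-monoˡ-≤ 5 (sumBelow-monoˡ-≤ u (λ w<u → ≤-trans 1≤excess-u (excess-antitone (<⇒≤ w<u) u≤m))) ⟩
    sumBelow excess u + 5                 ≡⟨ cong (sumBelow excess u +_) (sumBelow-bonus k) ⟨
    sumBelow excess u + sumBelow bonus u  ≡⟨ sumBelow-+ excess bonus u ⟨
    offset u                              ∎
    where
    open ≤-Reasoning
    1≤excess-u : 1 ≤ excess u
    1≤excess-u = subst (1 ≤_) (+-identityʳ (excess u)) 0<cu

  parent₂ : ℕ → ℕ
  parent₂ v = blockOf v (suc m)

  parent₂-≤ : ∀ {v} → v ≤ m → parent₂ v ≤ m
  parent₂-≤ {v} _ = blockOf-≤ v m

  parent₂-block : ∀ {v} → 0 < v → v ≤ m → InBlock (parent₂ v) v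
  parent₂-block 0<v v≤m = blockOf-∈ (suc m) 0<v (subst (_ ≤_) (sym offset-total) v≤m)

  parent₂-far : ∀ {v} → 0 < v → v ≤ m → parent₂ v ≢ 0 → parent₂ v + 3 ≤ v
  parent₂-far {v} 0<v v≤m p≢0 = subst (_≤ v) (sym (+-suc (parent₂ v) 2))
    (≤-trans (s≤s (offset-far (n≢0⇒n>0 p≢0) (parent₂-≤ v≤m) (block-nonempty {parent₂ v} v∈p))) (proj₁ v∈p))
    where
    v∈p : InBlock (parent₂ v) v
    v∈p = parent₂-block 0<v v≤m

  parent₂-< : ∀ {v} → v ≢ 0 → parent₂ v < v
  parent₂-< {v} v≢0 with v ≤? m | parent₂ v ≟ 0
  ... | no  v≰m | _       = <-≤-trans (s≤s (blockOf-≤ v m)) (≰⇒> v≰m)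
  ... | yes _   | yes p≡0 = subst (_< v) (sym p≡0) (n≢0⇒n>0 v≢0)
  ... | yes v≤m | no  p≢0 = <-≤-trans (m<m+n _ (s≤s z≤n)) (parent₂-far (n≢0⇒n>0 v≢0) v≤m p≢0)

  parent₂-m≢1 : parent₂ m ≢ 1
  parent₂-m≢1 p≡1 = <⇒≱ offset-2<m (subst (λ u → m ≤ offset (suc u)) p≡1 (proj₂ (parent₂-block (≤-trans (s≤s z≤n) 2≤m) ≤-refl)))

  parent₂-2 : parent₂ 2 ≡ 0
  parent₂-2 = block-unique (parent₂-block (s≤s z≤n) 2≤m) (s≤s z≤n , ≤-trans (s≤s (s≤s z≤n)) (m≤n+m 3 (excess 0)))

  module T₂ = ParentTree m parent₂ id parent₂-≤ parent₂-<

  children₂ : ∀ {x} → x ≤ m → T₂.children x ≡ childCount₂ x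
  children₂ {x} x≤m = begin
    T₂.children x
      ≡⟨ count-cong (λ y → T₂.isChild? y x) (inInterval? (offset x) (offset (suc x))) (suc m)
                    (λ y<1+m → mk⇔ (to (s≤s⁻¹ y<1+m)) (from (s≤s⁻¹ y<1+m))) ⟩
    count (inInterval? (offset x) (offset (suc x))) (suc m)
      ≡⟨ count-interval (suc m) (m≤m+n _ _) (s≤s (subst (offset (suc x) ≤_) offset-total (sumBelow-monoʳ-≤ childCount₂ (s≤s x≤m)))) ⟩
    offset (suc x) ∸ offset x
      ≡⟨ m+n∸m≡n (offset x) (childCount₂ x) ⟩
    childCount₂ x ∎
    where
    open ≡-Reasoning
    to : ∀ {y} → y ≤ m → T₂.IsChild y x → InBlock x y
    to y≤m (y≢0 , refl) = parent₂-block (n≢0⇒n>0 y≢0) y≤m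
    from : ∀ {y} → y ≤ m → InBlock x y → T₂.IsChild y x
    from y≤m y∈x = (λ { refl → n≮0 (proj₁ y∈x) })
                 , block-unique (parent₂-block (≤-trans (s≤s z≤n) (proj₁ y∈x)) y≤m) y∈x

  -- T₁ is the path 0 – 2 – 3 – ⋯ – m – 1.
  parent₁ : ℕ → ℕ
  parent₁ 0                   = 0
  parent₁ 1                   = m
  parent₁ 2                   = 0
  parent₁ (suc (suc (suc k))) = suc (suc k)

  rank₁ : ℕ → ℕ
  rank₁ 1 = suc m
  rank₁ x = x

  parent₁-≤ : ∀ {x} → x ≤ m → parent₁ x ≤ m
  parent₁-≤ {0}                 _   = z≤n
  parent₁-≤ {1}                 _   = ≤-refl
  parent₁-≤ {2}                 _   = z≤n
  parent₁-≤ {suc (suc (suc k))} x≤m = ≤-trans (n≤1+n _) x≤m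

  rank₁-parent : ∀ {x} → x ≢ 0 → rank₁ (parent₁ x) < rank₁ x
  rank₁-parent {0}                 0≢0 = contradiction refl 0≢0
  rank₁-parent {1}                 _   = ≤-reflexive (cong suc (rank₁-id 2≤m))
    where
    rank₁-id : ∀ {x} → 2 ≤ x → rank₁ x ≡ x
    rank₁-id (s≤s (s≤s _)) = refl
  rank₁-parent {2}                 _   = s≤s z≤n
  rank₁-parent {suc (suc (suc k))} _   = ≤-refl

  module T₁ = ParentTree m parent₁ rank₁ parent₁-≤ rank₁-parent

  child₁ : ℕ → ℕ
  child₁ 0 = 2
  child₁ (suc x) with suc x ≟ m
  ... | yes _ = 1
  ... | no  _ = suc (suc x)

  child₁-m : child₁ m ≡ 1
  child₁-m = subst (λ x → child₁ x ≡ 1) m-suc (child₁-suc (pred m) m-suc)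
    where
    m-suc : suc (pred m) ≡ m
    m-suc = suc-pred m {{>-nonZero (≤-trans (s≤s z≤n) 2≤m)}}
    child₁-suc : ∀ x → suc x ≡ m → child₁ (suc x) ≡ 1
    child₁-suc x 1+x≡m with suc x ≟ m
    ... | yes _     = refl
    ... | no  1+x≢m = contradiction 1+x≡m 1+x≢m

  child₁-parent₁ : ∀ {y} → y ≢ 0 → y ≤ m → child₁ (parent₁ y) ≡ y
  child₁-parent₁ {0}                 0≢0 _   = contradiction refl 0≢0
  child₁-parent₁ {1}                 _   _   = child₁-m
  child₁-parent₁ {2}                 _   _   = refl
  child₁-parent₁ {suc (suc (suc k))} _   y≤m with suc (suc k) ≟ m
  ... | yes 2+k≡m = contradiction (subst (suc (suc k) <_) (sym 2+k≡m) y≤m) (<-irrefl refl)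
  ... | no  _     = refl

  parent₁-child₁ : ∀ {x} → x ≢ 1 → parent₁ (child₁ x) ≡ x
  parent₁-child₁ {0}           _   = refl
  parent₁-child₁ {1}           1≢1 = contradiction refl 1≢1
  parent₁-child₁ {suc (suc x)} _   with suc (suc x) ≟ m
  ... | yes 2+x≡m = sym 2+x≡m
  ... | no  _     = refl

  child₁-≢0 : ∀ x → child₁ x ≢ 0
  child₁-≢0 0 ()
  child₁-≢0 (suc x) with suc x ≟ m
  ... | yes _ = λ ()
  ... | no  _ = λ ()

  child₁-≤ : ∀ {x} → x ≤ m → child₁ x ≤ m
  child₁-≤ {0}     _   = 2≤m
  child₁-≤ {suc x} x≤m with suc x ≟ m
  ... | yes _     = ≤-trans (s≤s z≤n) 2≤m
  ... | no  1+x≢m = ≤∧≢⇒< x≤m 1+x≢m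

  one-child₁ : ∀ {x} → x ≤ m → x ≢ 1 → T₁.children x ≡ 1
  one-child₁ {x} x≤m x≢1 = count-unique (λ y → T₁.isChild? y x) (suc m) (s≤s (child₁-≤ x≤m))
    (λ y<1+m → mk⇔ (λ { (y≢0 , refl) → sym (child₁-parent₁ y≢0 (s≤s⁻¹ y<1+m)) })
                   (λ { refl → child₁-≢0 x , parent₁-child₁ x≢1 }))

  childCount₁ : ℕ → ℕ
  childCount₁ 1 = 0
  childCount₁ _ = 1

  children₁ : ∀ {x} → x ≤ m → T₁.children x ≡ childCount₁ x
  children₁ {1}           _   = count-⊥ (λ y → T₁.isChild? y 1) (suc m) (λ _ → no-child)
    where
    no-child : ∀ {y} → ¬ T₁.IsChild y 1
    no-child {0}                 (0≢0 , _) = 0≢0 refl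
    no-child {1}                 (_ , m≡1) = <-irrefl (sym m≡1) 2≤m
    no-child {2}                 (_ , ())
    no-child {suc (suc (suc _))} (_ , ())
  children₁ {0}           x≤m = one-child₁ x≤m (λ ())
  children₁ {suc (suc x)} x≤m = one-child₁ x≤m (λ ())

  tree₁-edge : ∀ x y → x < y → T₁.Adjacent x y → (x ≡ 0 × y ≡ 2) ⊎ (2 ≤ x × suc x ≡ y) ⊎ (x ≡ 1 × y ≡ m)
  tree₁-edge 0                   _ _   (inj₁ (0≢0 , _))    = contradiction refl 0≢0
  tree₁-edge 1                   _ _   (inj₁ (_ , m≡y))    = inj₂ (inj₂ (refl , sym m≡y))
  tree₁-edge 2                   _ ()  (inj₁ (_ , refl))
  tree₁-edge (suc (suc (suc k))) _ x<y (inj₁ (_ , refl))   = contradiction x<y (<-asym (n<1+n _))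
  tree₁-edge _ 0                   ()  (inj₂ _)
  tree₁-edge x 1                   x<1 (inj₂ (_ , m≡x))    = contradiction (trans m≡x (n<1⇒n≡0 x<1)) m≢0
    where
    m≢0 : m ≢ 0
    m≢0 m≡0 = <-irrefl (sym m≡0) (≤-trans (s≤s z≤n) 2≤m)
  tree₁-edge _ 2                   _   (inj₂ (_ , refl))   = inj₁ (refl , refl)
  tree₁-edge _ (suc (suc (suc k))) _   (inj₂ (_ , refl))   = inj₂ (inj₁ (s≤s (s≤s z≤n) , refl))

  tree₂-edge⇒child : ∀ {x y} → x < y → T₂.Adjacent x y → T₂.IsChild y x
  tree₂-edge⇒child x<y (inj₁ (x≢0 , refl)) = contradiction x<y (<-asym (parent₂-< x≢0))
  tree₂-edge⇒child _   (inj₂ y↑x)          = y↑x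

  shared-edge< : ∀ {x y} → x < y → y ≤ m → T₁.Adjacent x y → T₂.Adjacent x y → x ≡ 0 × y ≡ 2
  shared-edge< {x} {y} x<y y≤m e₁ e₂ with tree₂-edge⇒child x<y e₂ | tree₁-edge x y x<y e₁
  ... | _         | inj₁ is-0-2                 = is-0-2
  ... | (_ , p≡x) | inj₂ (inj₁ (2≤x , refl))   =
    contradiction (subst (_≤ suc x) (trans (cong (_+ 3) p≡x) (+-comm x 3)) far) (<⇒≱ (s≤s (n≤1+n (suc x))))
    where
    far : parent₂ (suc x) + 3 ≤ suc x
    far = parent₂-far (s≤s z≤n) y≤m (λ p≡0 → contradiction (subst (2 ≤_) (trans (sym p≡x) p≡0) 2≤x) λ ())
  ... | (_ , p≡1) | inj₂ (inj₂ (refl , refl)) = contradiction p≡1 parent₂-m≢1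

  shared-edge : ∀ {x y} → x ≤ m → y ≤ m → T₁.Adjacent x y → T₂.Adjacent x y →
                 (x ≡ 0 × y ≡ 2) ⊎ (x ≡ 2 × y ≡ 0)
  shared-edge {x} {y} x≤m y≤m e₁ e₂ with <-cmp x y
  ... | tri< x<y _ _ = inj₁ (shared-edge< x<y y≤m e₁ e₂)
  ... | tri≈ _ refl _ = contradiction e₁ T₁.¬adjacent-self
  ... | tri> _ _ y<x = let (y≡0 , x≡2) = shared-edge< y<x x≤m (swap e₁) (swap e₂) in inj₂ (x≡2 , y≡0)

  edge-0-2₁ : T₁.Adjacent 0 2
  edge-0-2₁ = inj₂ ((λ ()) , refl)

  edge-0-2₂ : T₂.Adjacent 0 2
  edge-0-2₂ = inj₂ ((λ ()) , parent₂-2)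

  sharedAt : ℕ → ℕ
  sharedAt 0                   = 1
  sharedAt 1                   = 0
  sharedAt 2                   = 1
  sharedAt (suc (suc (suc _))) = 0

  adjacent₁₂? : ∀ x y → Dec (T₁.Adjacent x y × T₂.Adjacent x y)
  adjacent₁₂? x y = T₁.adjacent? x y ×-dec T₂.adjacent? x y

  no-shared-edge : ∀ {x} → x ≤ m → x ≢ 0 → x ≢ 2 → count (adjacent₁₂? x) (suc m) ≡ 0
  no-shared-edge x≤m x≢0 x≢2 = count-⊥ (adjacent₁₂? _) (suc m)
    (λ y<1+m (e₁ , e₂) → [ x≢0 ∘ proj₁ , x≢2 ∘ proj₁ ]′ (shared-edge x≤m (s≤s⁻¹ y<1+m) e₁ e₂))

  count-shared : ∀ {x} → x ≤ m → count (adjacent₁₂? x) (suc m) ≡ sharedAt x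
  count-shared {0} _ = count-unique (adjacent₁₂? 0) (suc m) (s≤s 2≤m)
    (λ y<1+m → mk⇔ (λ (e₁ , e₂) → [ proj₂ , (λ ()) ∘ proj₁ ]′ (shared-edge z≤n (s≤s⁻¹ y<1+m) e₁ e₂))
                   (λ { refl → edge-0-2₁ , edge-0-2₂ }))
  count-shared {2} _ = count-unique (adjacent₁₂? 2) (suc m) (s≤s z≤n)
    (λ y<1+m → mk⇔ (λ (e₁ , e₂) → [ (λ ()) ∘ proj₁ , proj₂ ]′ (shared-edge 2≤m (s≤s⁻¹ y<1+m) e₁ e₂))
                   (λ { refl → swap edge-0-2₁ , swap edge-0-2₂ }))
  count-shared {1}                     x≤m = no-shared-edge x≤m (λ ()) (λ ())
  count-shared {x@(suc (suc (suc _)))} x≤m = no-shared-edge x≤m (λ ()) (λ ())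

  G : Graph (suc m)
  G = T₁.tree ∪ T₂.tree

  deg-∪ : ∀ v → deg G v + sharedAt (toℕ v) ≡ deg T₁.tree v + deg T₂.tree v
  deg-∪ v = begin
    deg G v + sharedAt x
      ≡⟨ cong₂ _+_ (sumBelow-allFin (suc m) (λ y → b2n (does (T₁.adjacent? x y ⊎-dec T₂.adjacent? x y))))
                   (sym (count-shared (s≤s⁻¹ (toℕ<n v)))) ⟩
    count (λ y → T₁.adjacent? x y ⊎-dec T₂.adjacent? x y) (suc m) + count (adjacent₁₂? x) (suc m)
      ≡⟨ count-⊎ (T₁.adjacent? x) (T₂.adjacent? x) (suc m) ⟩
    count (T₁.adjacent? x) (suc m) + count (T₂.adjacent? x) (suc m)
      ≡⟨ cong₂ _+_ (sumBelow-allFin (suc m) (λ y → b2n (does (T₁.adjacent? x y))))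
                   (sumBelow-allFin (suc m) (λ y → b2n (does (T₂.adjacent? x y)))) ⟨
    deg T₁.tree v + deg T₂.tree v ∎
    where
    open ≡-Reasoning
    x = toℕ v

  -- The bonus children of T₂ supply exactly what is missing at the leaves 0 and 1 of T₁,
  -- at the common root 0, and at the shared edge {0, 2}.
  degree-budget : ∀ x → sign x + childCount₁ x + (sign x + bonus x) ≡ 3 + sharedAt x
  degree-budget 0                   = refl
  degree-budget 1                   = refl
  degree-budget 2                   = refl
  degree-budget (suc (suc (suc _))) = refl

  realizes : Realizes G d
  realizes i = +-cancelʳ-≡ (sharedAt x) (deg G i) (d i) (begin
    deg G i + sharedAt x                                      ≡⟨ deg-∪ i ⟩
    deg T₁.tree i + deg T₂.tree i                             ≡⟨ cong₂ _+_ (T₁.degree i) (T₂.degree i) ⟩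
    sign x + T₁.children x + (sign x + T₂.children x)         ≡⟨ cong₂ (λ a b → sign x + a + (sign x + b)) (children₁ x≤m) (children₂ x≤m) ⟩
    sign x + childCount₁ x + (sign x + (excess x + bonus x))  ≡⟨ regroup (sign x) (childCount₁ x) (excess x) (bonus x) ⟩
    excess x + (sign x + childCount₁ x + (sign x + bonus x))  ≡⟨ cong (excess x +_) (degree-budget x) ⟩
    excess x + (3 + sharedAt x)                               ≡⟨ +-assoc (excess x) 3 (sharedAt x) ⟨
    excess x + 3 + sharedAt x                                 ≡⟨ cong (_+ sharedAt x) (trans (sym (dℕ≡excess+3 x≤m)) (lookupℕ-toℕ d i)) ⟩
    d i + sharedAt x                                          ∎)
    where
    open ≡-Reasoning
    x = toℕ i
    x≤m = s≤s⁻¹ (toℕ<n i)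
    regroup : ∀ s p e b → s + p + (s + (e + b)) ≡ e + (s + p + (s + b))
    regroup = solve-∀

  two : Fin (suc m)
  two = fromℕ< (s≤s 2≤m)

  shares-one-edge : ShareExactlyOneEdge T₁.tree T₂.tree
  shares-one-edge = fzero , two , subst (0 <_) (sym two≡2) (s≤s z≤n)
                  , T₁.adjacent⇒edge (subst (T₁.Adjacent 0) (sym two≡2) edge-0-2₁)
                  , T₂.adjacent⇒edge (subst (T₂.Adjacent 0) (sym two≡2) edge-0-2₂)
                  , λ x y x<y e₁ e₂ →
                      let (x≡0 , y≡2) = shared-edge< x<y (s≤s⁻¹ (toℕ<n y)) (T₁.edge⇒adjacent e₁) (T₂.edge⇒adjacent e₂)
                      in toℕ-injective x≡0 , toℕ-injective (trans y≡2 (sym two≡2))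
    where
    two≡2 : toℕ two ≡ 2
    two≡2 = toℕ-fromℕ< (s≤s 2≤m)

lemma3p6 : (m : ℕ) (d : Fin (suc m) → ℕ) → Graphical d →
  seqSum d ≡ 4 * (suc m ∸ 1) ∸ 2 → d (fromℕ m) ≡ 3 →
  Σ (Graph (suc m)) λ G → Realizes G d × Σ (Graph (suc m)) λ T₁ → Σ (Graph (suc m)) λ T₂ →
    SpanningTree T₁ G × SpanningTree T₂ G × ShareExactlyOneEdge T₁ T₂
lemma3p6 m d (d-antitone , _) d-sum d-last =
  G , realizes , T₁.tree , T₂.tree
    , (∪-subgraphˡ T₁.tree T₂.tree , T₁.connected , T₁.acyclic)
    , (∪-subgraphʳ T₁.tree T₂.tree , T₂.connected , T₂.acyclic)
    , shares-one-edge
  where open Construction m d d-antitone d-sum d-last
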